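{- For any $n\in\mathbb{N}$, $a\in A$, and pointed models $\mathcal{M},u$ and $\mathcal{N},v$: (i) if $\mathcal{M},u\leftrightarrows^n_{ -a}\mathcal{N},v$ then $\mathcal{M},u\equiv_{\mathcal{L}^n_{ -a}}\mathcal{N},v$; (ii) if $\mathcal{M},u\leftrightarrows^n_{alt}\mathcal{N},v$ then $\mathcal{M},u\equiv_{\mathcal{L}^n_{alt}}\mathcal{N},v$; (iii) if $\mathcal{M},u\leftrightarrows^\omega_{ -a}\mathcal{N},v$ then $\mathcal{M},u\equiv_{\mathcal{L}_{ -a}}\mathcal{N},v$; (iv) if $\mathcal{M},u\leftrightarrows^\omega_{alt}\mathcal{N},v$ then $\mathcal{M},u\equiv_{\mathcal{L}_{alt}}\mathcal{N},v$.
   Context: Fix a set $A$ of agents with $|A|\ge 2$ and a countably infinite set $\mathsf{Prop}$. $\mathcal{L}$: $\varphi::=p\mid\neg\varphi\mid(\varphi\wedge\varphi)\mid\Box_a\varphi$ on Kripke models $\mathcal{M}=\langle W^{\mathcal{M}},\{R^{\mathcal{M}}_a\}_{a\in A},V^{\mathcal{M}}\rangle$; $V^{\mathcal{M}}(u)$ is the set of letters true at $u$; $\mathcal{M},u\equiv_{\mathcal{L}'}\mathcal{N},v$ means the pointed models agree on all formulas of $\mathcal{L}'$. $\mathcal{L}_{ -a}$ ($a\in A$): by simultaneous induction the least set containing $\mathsf{Prop}$, every $\Box_x\psi$ with $x\in A\setminus\{a\}$, $\psi\in\mathcal{L}_{ -x}$, closed under $\neg,\wedge$; $\mathcal{L}_{alt}$: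 least set containing $\mathsf{Prop}\cup\bigcup_a\mathcal{L}_{ -a}$ closed under $\neg,\wedge$. $\mathcal{L}^n_{ -a}$ and $\mathcal{L}^n_{alt}$ are the sets of formulas of modal depth at most $n$ in $\mathcal{L}_{ -a}$ and $\mathcal{L}_{alt}$ respectively. Finite bisimulations, by induction on $n$: $\mathcal{M},u\leftrightarrows^0_{ -a}\mathcal{N},v$ iff $V^{\mathcal{M}}(u)=V^{\mathcal{N}}(v)$; $\mathcal{M},u\leftrightarrows^{n+1}_{ -a}\mathcal{N},v$ iff $V^{\mathcal{M}}(u)=V^{\mathcal{N}}(v)$ and for all $b\in A\setminus\{a\}$: every $x\in R^{\mathcal{M}}_b(u)$ has some $y\in R^{\mathcal{N}}_b(v)$ with $\mathcal{M},x\leftrightarrows^n_{ -b}\mathcal{N},y$, and every $y\in R^{\mathcal{N}}_b(v)$ has some $x\in R^{\mathcal{M}}_b(u)$ with $\mathcal{M},x\leftrightarrows^n_{ -b}\mathcal{N},y$. $\leftrightarrows^0_{alt}$ is like $\leftrightarrows^0_{ -a}$, and $\leftrightarrows^{n+1}_{alt}$ is defined by the same conditions but for all $b\in A$. For $x\in A\cup\{alt\}$ (writing $\leftrightarrows^n_{ -a}$ for the agent case), $\leftrightarrows^\omega$ is the intersection over all $n\in\mathbb{N}$. -}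

module Defs where

open import Data.Nat using (ℕ; zero; suc; _⊔_; _≤_)
open import Data.Product using (Σ; _×_; _,_)
open import Relation.Binary.PropositionalEquality using (_≡_; _≢_)
open import Relation.Nullary using (¬_)
open import Function.Bundles using (_⇔_)

Letter : Set
Letter = ℕ

module Logic (Ag : Set) where

  record Model : Set₁ where
    field
      W : Set
      R : Ag → W → W → Set
      V : W → Letter → Set

  open Model public

  data Form : Set where
    var : Letter → Form
    ¬′_ : Form → Form
    _∧′_ : Form → Form → Form
    □ : Ag → Form → Form

  md : Form → ℕ
  md (var p) = 0
  md (¬′ φ) = md φ
  md (φ ∧′ ψ) = md φ ⊔ md ψ
  md (□ a φ) = suc (md φ)

  _,_⊨_ : (M : Model) → W M → Form → Set
  M , u ⊨ var p = V M u p
  M , u ⊨ (¬′ φ) = ¬ (M , u ⊨ φ)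
  M , u ⊨ (φ ∧′ ψ) = (M , u ⊨ φ) × (M , u ⊨ ψ)
  M , u ⊨ □ a φ = ∀ x → R M a u x → M , x ⊨ φ

  data InMinus (a : Ag) : Form → Set where
    var : ∀ p → InMinus a (var p)
    box : ∀ {x ψ} → x ≢ a → InMinus x ψ → InMinus a (□ x ψ)
    neg : ∀ {φ} → InMinus a φ → InMinus a (¬′ φ)
    con : ∀ {φ ψ} → InMinus a φ → InMinus a ψ → InMinus a (φ ∧′ ψ)

  data InAlt : Form → Set where
    var : ∀ p → InAlt (var p)
    minus : ∀ {a φ} → InMinus a φ → InAlt φ
    neg : ∀ {φ} → InAlt φ → InAlt (¬′ φ)
    con : ∀ {φ ψ} → InAlt φ → InAlt ψ → InAlt (φ ∧′ ψ)

  Equiv : (Form → Set) → (M : Model) → W M → (N : Model) → W N → Set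
  Equiv L M u N v = ∀ φ → L φ → ((M , u ⊨ φ) ⇔ (N , v ⊨ φ))

  MinusN : ℕ → Ag → Form → Set
  MinusN n a φ = InMinus a φ × md φ ≤ n

  AltN : ℕ → Form → Set
  AltN n φ = InAlt φ × md φ ≤ n

  SameVal : (M : Model) → W M → (N : Model) → W N → Set
  SameVal M u N v = ∀ p → (V M u p ⇔ V N v p)

  BisMinus : ℕ → Ag → (M : Model) → W M → (N : Model) → W N → Set
  BisMinus zero a M u N v = SameVal M u N v
  BisMinus (suc n) a M u N v =
    SameVal M u N v ×
    (∀ b → b ≢ a →
      (∀ x → R M b u x → Σ (W N) λ y → R N b v y × BisMinus n b M x N y) ×
      (∀ y → R N b v y → Σ (W M) λ x → R M b u x × BisMinus n b M x N y))

  BisAlt : ℕ → (M : Model) → W M → (N : Model) → W N → Set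
  BisAlt zero M u N v = SameVal M u N v
  BisAlt (suc n) M u N v =
    SameVal M u N v ×
    (∀ b →
      (∀ x → R M b u x → Σ (W N) λ y → R N b v y × BisMinus n b M x N y) ×
      (∀ y → R N b v y → Σ (W M) λ x → R M b u x × BisMinus n b M x N y))

  BisMinusω : Ag → (M : Model) → W M → (N : Model) → W N → Set
  BisMinusω a M u N v = ∀ n → BisMinus n a M u N v

  BisAltω : (M : Model) → W M → (N : Model) → W N → Set
  BisAltω M u N v = ∀ n → BisAlt n M u N v

-- A letter is settled by the shared valuation, ¬ and ∧ preserve
-- agreement, and a box □_b ψ in L_{-a} has b ≠ a and ψ ∈ L_{-b} of smaller depth, which
-- is exactly what the b-clause of ⇆^{n+1}_{-a} provides via the induction hypothesis at
-- ⇆^n_{-b}. An L_alt formula is a Boolean combination of letters and L_{-a} formulas, and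
-- ⇆^n_alt implies ⇆^n_{-a} for every a. The ω cases instantiate n with the modal depth.
module Submission where

open import Defs
open import Data.Nat using (ℕ; zero; suc; s≤s)
open import Data.Nat.Properties using (m⊔n≤o⇒m≤o; m⊔n≤o⇒n≤o; ≤-refl)
open import Data.Product using (Σ; _×_; _,_; proj₁; proj₂)
open import Data.Product.Function.NonDependent.Propositional using (_×-⇔_)
open import Function.Bundles using (_⇔_; mk⇔; Equivalence)
open import Function.Related.TypeIsomorphisms using (¬-cong-⇔)
open import Relation.Binary.PropositionalEquality using (_≢_)
open Logic

module _ {Ag : Set} where
  open Equivalence

  private
    Sat : (M : Model Ag) → W M → Form Ag → Set
    Sat = _,_⊨_ Ag

  BisMinus⇒SameVal : ∀ n a {M : Model Ag} {u} {N : Model Ag} {v} →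
    BisMinus Ag n a M u N v → SameVal Ag M u N v
  BisMinus⇒SameVal zero    a bis = bis
  BisMinus⇒SameVal (suc n) a bis = proj₁ bis

  BisAlt⇒BisMinus : ∀ n a {M : Model Ag} {u} {N : Model Ag} {v} →
    BisAlt Ag n M u N v → BisMinus Ag n a M u N v
  BisAlt⇒BisMinus zero    a bis          = bis
  BisAlt⇒BisMinus (suc n) a (val , zigzag) = val , λ b _ → zigzag b

  BisAlt⇒SameVal : ∀ n {M : Model Ag} {u} {N : Model Ag} {v} →
    BisAlt Ag n M u N v → SameVal Ag M u N v
  BisAlt⇒SameVal zero    bis = bis
  BisAlt⇒SameVal (suc n) bis = proj₁ bis

  □-cong-⇔ : ∀ b ψ {M : Model Ag} {u} {N : Model Ag} {v} →
    (∀ x → R M b u x → Σ (W N) λ y → R N b v y × (Sat M x ψ ⇔ Sat N y ψ)) →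
    (∀ y → R N b v y → Σ (W M) λ x → R M b u x × (Sat M x ψ ⇔ Sat N y ψ)) →
    Sat M u (□ b ψ) ⇔ Sat N v (□ b ψ)
  □-cong-⇔ b ψ forth back = mk⇔
    (λ M⊨□ y vRy → let (x , uRx , x≡y) = back y vRy in to x≡y (M⊨□ x uRx))
    (λ N⊨□ x uRx → let (y , vRy , x≡y) = forth x uRx in from x≡y (N⊨□ y vRy))

  BisMinus⇒≡MinusN : ∀ n a {M : Model Ag} {u} {N : Model Ag} {v} →
    BisMinus Ag n a M u N v → Equiv Ag (MinusN Ag n a) M u N v
  BisMinus⇒≡MinusN n a bis .(var p) (var p , _) = BisMinus⇒SameVal n a bis p
  BisMinus⇒≡MinusN n a bis .(¬′ φ) (neg {φ} φ∈ , dφ≤n) =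
    ¬-cong-⇔ (BisMinus⇒≡MinusN n a bis φ (φ∈ , dφ≤n))
  BisMinus⇒≡MinusN n a bis .(φ ∧′ ψ) (con {φ} {ψ} φ∈ ψ∈ , d≤n) =
    BisMinus⇒≡MinusN n a bis φ (φ∈ , m⊔n≤o⇒m≤o (md Ag φ) (md Ag ψ) d≤n)
      ×-⇔ BisMinus⇒≡MinusN n a bis ψ (ψ∈ , m⊔n≤o⇒n≤o (md Ag φ) (md Ag ψ) d≤n)
  BisMinus⇒≡MinusN (suc n) a (_ , zigzag) .(□ b ψ) (box {b} {ψ} b≢a ψ∈ , s≤s dψ≤n) =
    □-cong-⇔ b ψ
      (λ x uRx → let (y , vRy , bis) = proj₁ (zigzag b b≢a) x uRx in
                 y , vRy , BisMinus⇒≡MinusN n b bis ψ (ψ∈ , dψ≤n))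
      (λ y vRy → let (x , uRx , bis) = proj₂ (zigzag b b≢a) y vRy in
                 x , uRx , BisMinus⇒≡MinusN n b bis ψ (ψ∈ , dψ≤n))

  BisAlt⇒≡AltN : ∀ n {M : Model Ag} {u} {N : Model Ag} {v} →
    BisAlt Ag n M u N v → Equiv Ag (AltN Ag n) M u N v
  BisAlt⇒≡AltN n bis .(var p) (var p , _) = BisAlt⇒SameVal n bis p
  BisAlt⇒≡AltN n bis φ (minus {a} φ∈ , dφ≤n) =
    BisMinus⇒≡MinusN n a (BisAlt⇒BisMinus n a bis) φ (φ∈ , dφ≤n)
  BisAlt⇒≡AltN n bis .(¬′ φ) (neg {φ} φ∈ , dφ≤n) =
    ¬-cong-⇔ (BisAlt⇒≡AltN n bis φ (φ∈ , dφ≤n))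
  BisAlt⇒≡AltN n bis .(φ ∧′ ψ) (con {φ} {ψ} φ∈ ψ∈ , d≤n) =
    BisAlt⇒≡AltN n bis φ (φ∈ , m⊔n≤o⇒m≤o (md Ag φ) (md Ag ψ) d≤n)
      ×-⇔ BisAlt⇒≡AltN n bis ψ (ψ∈ , m⊔n≤o⇒n≤o (md Ag φ) (md Ag ψ) d≤n)

  BisMinusω⇒≡Minus : ∀ a {M : Model Ag} {u} {N : Model Ag} {v} →
    BisMinusω Ag a M u N v → Equiv Ag (InMinus Ag a) M u N v
  BisMinusω⇒≡Minus a bis φ φ∈ =
    BisMinus⇒≡MinusN (md Ag φ) a (bis (md Ag φ)) φ (φ∈ , ≤-refl)

  BisAltω⇒≡Alt : ∀ {M : Model Ag} {u} {N : Model Ag} {v} →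
    BisAltω Ag M u N v → Equiv Ag (InAlt Ag) M u N v
  BisAltω⇒≡Alt bis φ φ∈ = BisAlt⇒≡AltN (md Ag φ) (bis (md Ag φ)) φ (φ∈ , ≤-refl)

mainTheorem16 : (Ag : Set) → Σ Ag (λ a₁ → Σ Ag (λ a₂ → a₁ ≢ a₂)) →
    (n : ℕ) (a : Ag) (M : Model Ag) (u : W M) (N : Model Ag) (v : W N) →
      (BisMinus Ag n a M u N v → Equiv Ag (MinusN Ag n a) M u N v)
      × (BisAlt Ag n M u N v → Equiv Ag (AltN Ag n) M u N v)
      × (BisMinusω Ag a M u N v → Equiv Ag (InMinus Ag a) M u N v)
      × (BisAltω Ag M u N v → Equiv Ag (InAlt Ag) M u N v)
mainTheorem16 Ag _ n a M u N v =
  BisMinus⇒≡MinusN n a , BisAlt⇒≡AltN n , BisMinusω⇒≡Minus a , BisAltω⇒≡Alt
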